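{- The functor $\vec D:\mathfrak M\to\mathfrak Q$, equipped with the maps $\psi_{G,H}$ and $\psi_\bullet$ below, is strong symmetric monoidal from $(\mathfrak M,\Box,V^\diamond(\{1\}))$ to $(\mathfrak Q,\vec\Box,\vec V^\diamond(\{1\}))$.
   Context: Multigraphs: $(V,E,\epsilon:E\to\mathcal PV)$ with $1\le|\epsilon(e)|\le2$; homomorphisms $(V\phi,E\phi)$ with $\epsilon_H(E\phi(e))=V\phi[\epsilon_G(e)]$; category $\mathfrak M$. Box product: $V(G\Box H)=V(G)\times V(H)$, $E(G\Box H)=(\{1\}\times E(G)\times V(H))\cup(\{2\}\times V(G)\times E(H))$, $\epsilon(1,x,y)=\epsilon_G(x)\times\{y\}$, $\epsilon(2,x,y)=\{x\}\times\epsilon_H(y)$; unit $V^\diamond(\{1\})$ (one vertex, no edges); structure maps $r_G(v,1)=v$, $r_G(1,e,1)=e$; $\ell_G(1,v)=v$, $\ell_G(2,1,e)=e$; $c(v,w)=(w,v)$, $c(n,x,y)=(3-n,y,x)$; $a((v,w),u)=(v,(w,u))$, $a(1,(1,e,w),u)=(1,e,(w,u))$, $a(1,(2,v,f),u)=(2,v,(1,f,u))$, $a(2,(v,w),g)=(2,v,(2,w,g))$. Quivers $(\vec V,\vec E,\sigma,\tau)$, category $\mathfrak Q$, box product $\vec V(Q\vec\Box P)=\vec V(Q)\times\vec V(P)$, $\vec E(Q\vec\Box P)=(\{1\}\times\vec E(Q)\times\vec V(P))\cup(\{2\}\times\vec V(Q)\times\vec E(P))$, $\sigma(1,x,y)=(\sigma_Qx,y)$,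 $\sigma(2,x,y)=(x,\sigma_Py)$, $\tau(1,x,y)=(\tau_Qx,y)$, $\tau(2,x,y)=(x,\tau_Py)$; unit $\vec V^\diamond(\{1\})$ (one vertex $1$, no edges); structure maps by the same formulas as in $\mathfrak M$. $\vec D:\mathfrak M\to\mathfrak Q$: $\vec V(\vec DG)=V(G)$, $\vec E(\vec DG)=\{(e,x,y):e\in E(G),\ \epsilon_G(e)=\{x,y\}\}$, $\sigma(e,x,y)=x$, $\tau(e,x,y)=y$; on morphisms $(e,x,y)\mapsto(E\phi(e),V\phi(x),V\phi(y))$. Structure maps: $\psi_{G,H}:\vec D(G)\vec\Box\vec D(H)\to\vec D(G\Box H)$ with $\vec V(\psi)(v,w)=(v,w)$, $\vec E(\psi)(1,(e,v,z),w)=((1,e,w),(v,w),(z,w))$, $\vec E(\psi)(2,v,(f,w,u))=((2,v,f),(v,w),(v,u))$; $\psi_\bullet:\vec V^\diamond(\{1\})\to\vec D(V^\diamond(\{1\}))$ with $\vec V(\psi_\bullet)(1)=1$. Strong symmetric monoidal: $\psi$ natural, $\psi_{G,H},\psi_\bullet$ isomorphisms, and standard associativity, unitality and symmetry coherence diagrams commute. -}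

module Defs where

open import Level using (0ℓ)
open import Data.Unit using (⊤; tt)
open import Data.Empty using (⊥; ⊥-elim)
import Data.Empty.Irrelevant as Irr
open import Data.Product using (Σ; _×_; _,_; proj₁; proj₂)
open import Data.Sum using (_⊎_; inj₁; inj₂)
open import Relation.Nullary using (¬_)
open import Relation.Binary.PropositionalEquality
open import Relation.Unary using (Pred; _≐_)

-- Subsets of V with 1 or 2 elements.
-- `one v` is {v};  `two v w _` is {v,w} with v ≠ w.
-- (Every such subset is coded; {v,w} has the two codes two v w / two w v.)

data Ends (V : Set) : Set where
  one : V → Ends V
  two : (v w : V) → .(¬ v ≡ w) → Ends V

⟦_⟧ : {V : Set} → Ends V → Pred V 0ℓ
⟦ one v ⟧ z = z ≡ v
⟦ two v w _ ⟧ z = z ≡ v ⊎ z ≡ w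

image : {V W : Set} → (V → W) → Pred V 0ℓ → Pred W 0ℓ
image {V} f P w = Σ V λ v → P v × f v ≡ w

-- `IsEnds A x y` : the relation  A = {x , y}  (as sets); a proposition.
data IsEnds {V : Set} : Ends V → V → V → Set where
  lp : ∀ {v} → IsEnds (one v) v v
  fw : ∀ {v w} .{p : ¬ v ≡ w} → IsEnds (two v w p) v w
  bw : ∀ {v w} .{p : ¬ v ≡ w} → IsEnds (two v w p) w v

record Multigraph : Set₁ where
  field
    V : Set
    E : Set
    ε : E → Ends V
open Multigraph public

record MHom (G H : Multigraph) : Set where
  field
    Vφ : V G → V H
    Eφ : E G → E H
    hom : ∀ e → ⟦ ε H (Eφ e) ⟧ ≐ image Vφ ⟦ ε G e ⟧
open MHom public

record Quiver : Set₁ where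
  field
    QV : Set
    QE : Set
    σ : QE → QV
    τ : QE → QV
open Quiver public

record QHom (Q P : Quiver) : Set where
  field
    Vf : QV Q → QV P
    Ef : QE Q → QE P
    σ-hom : ∀ e → σ P (Ef e) ≡ Vf (σ Q e)
    τ-hom : ∀ e → τ P (Ef e) ≡ Vf (τ Q e)
open QHom public

idQ : (Q : Quiver) → QHom Q Q
idQ Q = record { Vf = λ v → v ; Ef = λ e → e ; σ-hom = λ _ → refl ; τ-hom = λ _ → refl }

infixr 9 _∘Q_
_∘Q_ : {Q P R : Quiver} → QHom P R → QHom Q P → QHom Q R
_∘Q_ {Q} {P} {R} g f = record
  { Vf = λ v → Vf g (Vf f v)
  ; Ef = λ e → Ef g (Ef f e)
  ; σ-hom = λ e → trans (σ-hom g (Ef f e)) (cong (Vf g) (σ-hom f e))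
  ; τ-hom = λ e → trans (τ-hom g (Ef f e)) (cong (Vf g) (τ-hom f e))
  }

infix 4 _≈Q_
_≈Q_ : {Q P : Quiver} → QHom Q P → QHom Q P → Set
f ≈Q g = (∀ v → Vf f v ≡ Vf g v) × (∀ e → Ef f e ≡ Ef g e)

IsIsoQ : {Q P : Quiver} → QHom Q P → Set
IsIsoQ {Q} {P} f = Σ (QHom P Q) λ g → (g ∘Q f ≈Q idQ Q) × (f ∘Q g ≈Q idQ P)

-- Box product of quivers.  Edge (1,x,y) is inj₁ (x , y); (2,x,y) is inj₂ (x , y).

infixr 7 _⊠_
_⊠_ : Quiver → Quiver → Quiver
Q ⊠ P = record
  { QV = QV Q × QV P
  ; QE = (QE Q × QV P) ⊎ (QV Q × QE P)
  ; σ = λ { (inj₁ (x , y)) → (σ Q x , y) ; (inj₂ (x , y)) → (x , σ P y) }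
  ; τ = λ { (inj₁ (x , y)) → (τ Q x , y) ; (inj₂ (x , y)) → (x , τ P y) }
  }

_⊠₁_ : {Q Q' P P' : Quiver} → QHom Q Q' → QHom P P' → QHom (Q ⊠ P) (Q' ⊠ P')
_⊠₁_ f g = record
  { Vf = λ { (a , b) → (Vf f a , Vf g b) }
  ; Ef = λ { (inj₁ (x , y)) → inj₁ (Ef f x , Vf g y) ; (inj₂ (x , y)) → inj₂ (Vf f x , Ef g y) }
  ; σ-hom = λ { (inj₁ (x , y)) → cong (_, Vf g y) (σ-hom f x) ; (inj₂ (x , y)) → cong (Vf f x ,_) (σ-hom g y) }
  ; τ-hom = λ { (inj₁ (x , y)) → cong (_, Vf g y) (τ-hom f x) ; (inj₂ (x , y)) → cong (Vf f x ,_) (τ-hom g y) }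
  }

IQ : Quiver
IQ = record { QV = ⊤ ; QE = ⊥ ; σ = λ () ; τ = λ () }

aQ : (Q P R : Quiver) → QHom ((Q ⊠ P) ⊠ R) (Q ⊠ (P ⊠ R))
aQ Q P R = record
  { Vf = λ { ((v , w) , u) → (v , (w , u)) }
  ; Ef = λ { (inj₁ (inj₁ (e , w) , u)) → inj₁ (e , (w , u))
           ; (inj₁ (inj₂ (v , f) , u)) → inj₂ (v , inj₁ (f , u))
           ; (inj₂ ((v , w) , g)) → inj₂ (v , inj₂ (w , g)) }
  ; σ-hom = λ { (inj₁ (inj₁ _ , _)) → refl ; (inj₁ (inj₂ _ , _)) → refl ; (inj₂ _) → refl }
  ; τ-hom = λ { (inj₁ (inj₁ _ , _)) → refl ; (inj₁ (inj₂ _ , _)) → refl ; (inj₂ _) → refl }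
  }

rQ : (Q : Quiver) → QHom (Q ⊠ IQ) Q
rQ Q = record
  { Vf = λ { (v , tt) → v }
  ; Ef = λ { (inj₁ (e , tt)) → e ; (inj₂ (_ , ())) }
  ; σ-hom = λ { (inj₁ (e , tt)) → refl ; (inj₂ (_ , ())) }
  ; τ-hom = λ { (inj₁ (e , tt)) → refl ; (inj₂ (_ , ())) }
  }

ℓQ : (Q : Quiver) → QHom (IQ ⊠ Q) Q
ℓQ Q = record
  { Vf = λ { (tt , v) → v }
  ; Ef = λ { (inj₂ (tt , e)) → e ; (inj₁ (() , _)) }
  ; σ-hom = λ { (inj₂ (tt , e)) → refl ; (inj₁ (() , _)) }
  ; τ-hom = λ { (inj₂ (tt , e)) → refl ; (inj₁ (() , _)) }
  }

cQ : (Q P : Quiver) → QHom (Q ⊠ P) (P ⊠ Q)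
cQ Q P = record
  { Vf = λ { (v , w) → (w , v) }
  ; Ef = λ { (inj₁ (x , y)) → inj₂ (y , x) ; (inj₂ (x , y)) → inj₁ (y , x) }
  ; σ-hom = λ { (inj₁ _) → refl ; (inj₂ _) → refl }
  ; τ-hom = λ { (inj₁ _) → refl ; (inj₂ _) → refl }
  }

leftT : {V W : Set} → Ends V → W → Ends (V × W)
leftT (one v) y = one (v , y)
leftT (two v w p) y = two (v , y) (w , y) (λ q → p (cong proj₁ q))

rightT : {V W : Set} → V → Ends W → Ends (V × W)
rightT x (one v) = one (x , v)
rightT x (two v w p) = two (x , v) (x , w) (λ q → p (cong proj₂ q))

infixr 7 _□_
_□_ : Multigraph → Multigraph → Multigraph
G □ H = record
  { V = V G × V H
  ; E = (E G × V H) ⊎ (V G × E H)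
  ; ε = λ { (inj₁ (x , y)) → leftT (ε G x) y ; (inj₂ (x , y)) → rightT x (ε H y) }
  }

IM : Multigraph
IM = record { V = ⊤ ; E = ⊥ ; ε = λ () }

private
  variable
    A' B' C' D' : Set

mapI : (f : A' → B') → (∀ {a b} → f a ≡ f b → a ≡ b) → Ends A' → Ends B'
mapI f inj (one v) = one (f v)
mapI f inj (two v w p) = two (f v) (f w) (λ q → p (inj q))

mapI-hom : (f : A' → B') (inj : ∀ {a b} → f a ≡ f b → a ≡ b) (X : Ends A') →
           ⟦ mapI f inj X ⟧ ≐ image f ⟦ X ⟧
mapI-hom f inj (one v) = (λ { refl → v , refl , refl }) , (λ { (_ , refl , refl) → refl })
mapI-hom f inj (two v w p) =
  (λ { (inj₁ refl) → v , inj₁ refl , refl ; (inj₂ refl) → w , inj₂ refl , refl })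
  , (λ { (_ , inj₁ refl , refl) → inj₁ refl ; (_ , inj₂ refl , refl) → inj₂ refl })

viaMapI : (f : A' → B') (inj : ∀ {a b} → f a ≡ f b → a ≡ b) (X : Ends A') (Y : Ends B') →
          Y ≡ mapI f inj X → ⟦ Y ⟧ ≐ image f ⟦ X ⟧
viaMapI f inj X _ refl = mapI-hom f inj X

memL→ : (X : Ends A') (y : B') {z : A' × B'} → ⟦ leftT X y ⟧ z → Σ A' λ v → ⟦ X ⟧ v × z ≡ (v , y)
memL→ (one v) y q = v , refl , q
memL→ (two v w p) y (inj₁ q) = v , inj₁ refl , q
memL→ (two v w p) y (inj₂ q) = w , inj₂ refl , q

memL← : (X : Ends A') (y : B') (v : A') → ⟦ X ⟧ v → ⟦ leftT X y ⟧ (v , y)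
memL← (one v) y .v refl = refl
memL← (two v w p) y .v (inj₁ refl) = inj₁ refl
memL← (two v w p) y .w (inj₂ refl) = inj₂ refl

memR→ : (x : A') (X : Ends B') {z : A' × B'} → ⟦ rightT x X ⟧ z → Σ B' λ v → ⟦ X ⟧ v × z ≡ (x , v)
memR→ x (one v) q = v , refl , q
memR→ x (two v w p) (inj₁ q) = v , inj₁ refl , q
memR→ x (two v w p) (inj₂ q) = w , inj₂ refl , q

memR← : (x : A') (X : Ends B') (v : B') → ⟦ X ⟧ v → ⟦ rightT x X ⟧ (x , v)
memR← x (one v) .v refl = refl
memR← x (two v w p) .v (inj₁ refl) = inj₁ refl
memR← x (two v w p) .w (inj₂ refl) = inj₂ refl

leftT-hom : (f : A' → C') (g : B' → D') (X : Ends A') (Y : Ends C') (y : B') →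
            ⟦ Y ⟧ ≐ image f ⟦ X ⟧ →
            ⟦ leftT Y (g y) ⟧ ≐ image (λ { (a , b) → (f a , g b) }) ⟦ leftT X y ⟧
leftT-hom f g X Y y h = to , from
  where
  to : ∀ {z} → ⟦ leftT Y (g y) ⟧ z → image _ ⟦ leftT X y ⟧ z
  to m with memL→ Y (g y) m
  ... | u , uY , refl with proj₁ h uY
  ... | v , vX , refl = (v , y) , memL← X y v vX , refl
  from : ∀ {z} → image _ ⟦ leftT X y ⟧ z → ⟦ leftT Y (g y) ⟧ z
  from ((v' , y') , m , refl) with memL→ X y m
  ... | v , vX , refl = memL← Y (g y) (f v) (proj₂ h (v , vX , refl))

rightT-hom : (f : A' → C') (g : B' → D') (X : Ends B') (Y : Ends D') (x : A') →
             ⟦ Y ⟧ ≐ image g ⟦ X ⟧ →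
             ⟦ rightT (f x) Y ⟧ ≐ image (λ { (a , b) → (f a , g b) }) ⟦ rightT x X ⟧
rightT-hom f g X Y x h = to , from
  where
  to : ∀ {z} → ⟦ rightT (f x) Y ⟧ z → image _ ⟦ rightT x X ⟧ z
  to m with memR→ (f x) Y m
  ... | u , uY , refl with proj₁ h uY
  ... | v , vX , refl = (x , v) , memR← x X v vX , refl
  from : ∀ {z} → image _ ⟦ rightT x X ⟧ z → ⟦ rightT (f x) Y ⟧ z
  from ((x' , v') , m , refl) with memR→ x X m
  ... | v , vX , refl = memR← (f x) Y (g v) (proj₂ h (v , vX , refl))

_□₁_ : {G G' H H' : Multigraph} → MHom G G' → MHom H H' → MHom (G □ H) (G' □ H')
_□₁_ {G} {G'} {H} {H'} φ χ = record
  { Vφ = λ { (a , b) → (Vφ φ a , Vφ χ b) }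
  ; Eφ = λ { (inj₁ (x , y)) → inj₁ (Eφ φ x , Vφ χ y) ; (inj₂ (x , y)) → inj₂ (Vφ φ x , Eφ χ y) }
  ; hom = λ { (inj₁ (x , y)) → leftT-hom (Vφ φ) (Vφ χ) (ε G x) (ε G' (Eφ φ x)) y (hom φ x)
            ; (inj₂ (x , y)) → rightT-hom (Vφ φ) (Vφ χ) (ε H y) (ε H' (Eφ χ y)) x (hom χ y) }
  }

private
  aV : {X Y Z : Set} → (X × Y) × Z → X × (Y × Z)
  aV ((v , w) , u) = (v , (w , u))
  aV⁻ : {X Y Z : Set} → X × (Y × Z) → (X × Y) × Z
  aV⁻ (v , (w , u)) = ((v , w) , u)
  aInj : {X Y Z : Set} {a b : (X × Y) × Z} → aV a ≡ aV b → a ≡ b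
  aInj q = cong aV⁻ q

  a1 : {X Y Z : Set} (A : Ends X) (w : Y) (u : Z) → leftT A (w , u) ≡ mapI aV aInj (leftT (leftT A w) u)
  a1 (one _) w u = refl
  a1 (two _ _ _) w u = refl
  a2 : {X Y Z : Set} (v : X) (A : Ends Y) (u : Z) → rightT v (leftT A u) ≡ mapI aV aInj (leftT (rightT v A) u)
  a2 v (one _) u = refl
  a2 v (two _ _ _) u = refl
  a3 : {X Y Z : Set} (v : X) (w : Y) (A : Ends Z) → rightT v (rightT w A) ≡ mapI aV aInj (rightT (v , w) A)
  a3 v w (one _) = refl
  a3 v w (two _ _ _) = refl

aM : (G H K : Multigraph) → MHom ((G □ H) □ K) (G □ (H □ K))
aM G H K = record
  { Vφ = aV
  ; Eφ = λ { (inj₁ (inj₁ (e , w) , u)) → inj₁ (e , (w , u))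
           ; (inj₁ (inj₂ (v , f) , u)) → inj₂ (v , inj₁ (f , u))
           ; (inj₂ ((v , w) , g)) → inj₂ (v , inj₂ (w , g)) }
  ; hom = λ { (inj₁ (inj₁ (e , w) , u)) → viaMapI aV aInj _ _ (a1 (ε G e) w u)
            ; (inj₁ (inj₂ (v , f) , u)) → viaMapI aV aInj _ _ (a2 v (ε H f) u)
            ; (inj₂ ((v , w) , g)) → viaMapI aV aInj _ _ (a3 v w (ε K g)) }
  }

private
  rInj : {X : Set} {a b : X × ⊤} → proj₁ a ≡ proj₁ b → a ≡ b
  rInj q = cong (_, tt) q
  r1 : {X : Set} (A : Ends X) → A ≡ mapI proj₁ rInj (leftT A tt)
  r1 (one _) = refl
  r1 (two _ _ _) = refl
  lInj : {X : Set} {a b : ⊤ × X} → proj₂ a ≡ proj₂ b → a ≡ b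
  lInj q = cong (tt ,_) q
  l1 : {X : Set} (A : Ends X) → A ≡ mapI proj₂ lInj (rightT tt A)
  l1 (one _) = refl
  l1 (two _ _ _) = refl

rM : (G : Multigraph) → MHom (G □ IM) G
rM G = record
  { Vφ = proj₁
  ; Eφ = λ { (inj₁ (e , tt)) → e ; (inj₂ (_ , ())) }
  ; hom = λ { (inj₁ (e , tt)) → viaMapI proj₁ rInj _ _ (r1 (ε G e)) ; (inj₂ (_ , ())) }
  }

ℓM : (G : Multigraph) → MHom (IM □ G) G
ℓM G = record
  { Vφ = proj₂
  ; Eφ = λ { (inj₂ (tt , e)) → e ; (inj₁ (() , _)) }
  ; hom = λ { (inj₂ (tt , e)) → viaMapI proj₂ lInj _ _ (l1 (ε G e)) ; (inj₁ (() , _)) }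
  }

private
  sw : {X Y : Set} → X × Y → Y × X
  sw (v , w) = (w , v)
  swInj : {X Y : Set} {a b : X × Y} → sw a ≡ sw b → a ≡ b
  swInj q = cong sw q
  c1 : {X Y : Set} (A : Ends X) (y : Y) → rightT y A ≡ mapI sw swInj (leftT A y)
  c1 (one _) y = refl
  c1 (two _ _ _) y = refl
  c2 : {X Y : Set} (x : X) (A : Ends Y) → leftT A x ≡ mapI sw swInj (rightT x A)
  c2 x (one _) = refl
  c2 x (two _ _ _) = refl

cM : (G H : Multigraph) → MHom (G □ H) (H □ G)
cM G H = record
  { Vφ = sw
  ; Eφ = λ { (inj₁ (x , y)) → inj₂ (y , x) ; (inj₂ (x , y)) → inj₁ (y , x) }
  ; hom = λ { (inj₁ (x , y)) → viaMapI sw swInj _ _ (c1 (ε G x) y)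
            ; (inj₂ (x , y)) → viaMapI sw swInj _ _ (c2 x (ε H y)) }
  }

record DEdge (G : Multigraph) : Set where
  constructor dedge
  field
    edge : E G
    src : V G
    tgt : V G
    ok : IsEnds (ε G edge) src tgt
open DEdge public

DQ : Multigraph → Quiver
DQ G = record { QV = V G ; QE = DEdge G ; σ = src ; τ = tgt }

private
  memS : {X : Set} {A : Ends X} {x y : X} → IsEnds A x y → ⟦ A ⟧ x
  memS lp = refl
  memS fw = inj₁ refl
  memS bw = inj₂ refl
  memT : {X : Set} {A : Ends X} {x y : X} → IsEnds A x y → ⟦ A ⟧ y
  memT lp = refl
  memT fw = inj₂ refl
  memT bw = inj₁ refl
  elems : {X : Set} {A : Ends X} {x y v : X} → IsEnds A x y → ⟦ A ⟧ v → v ≡ x ⊎ v ≡ y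
  elems lp q = inj₁ q
  elems fw (inj₁ q) = inj₁ q
  elems fw (inj₂ q) = inj₂ q
  elems bw (inj₁ q) = inj₂ q
  elems bw (inj₂ q) = inj₁ q
  mk1 : {X : Set} {a b u : X} → a ≡ u → b ≡ u → IsEnds (one u) a b
  mk1 refl refl = lp
  mk2 : {X : Set} {u u' a b : X} .{p : ¬ u ≡ u'} → u ≡ a ⊎ u ≡ b → u' ≡ a ⊎ u' ≡ b → IsEnds (two u u' p) a b
  mk2 (inj₁ refl) (inj₂ refl) = fw
  mk2 (inj₂ refl) (inj₁ refl) = bw
  mk2 {p = p} (inj₁ q) (inj₁ q') = Irr.⊥-elim (p (trans q (sym q')))
  mk2 {p = p} (inj₂ q) (inj₂ q') = Irr.⊥-elim (p (trans q (sym q')))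

transportEnds : {X Y : Set} (f : X → Y) (A : Ends X) (B : Ends Y) →
                ⟦ B ⟧ ≐ image f ⟦ A ⟧ → {x y : X} → IsEnds A x y → IsEnds B (f x) (f y)
transportEnds f A (one u) h ie = mk1 (proj₂ h (_ , memS ie , refl)) (proj₂ h (_ , memT ie , refl))
transportEnds f A (two u u' p) h {x} {y} ie = mk2 (side (proj₁ h (inj₁ refl))) (side (proj₁ h (inj₂ refl)))
  where
  side : ∀ {t} → image f ⟦ A ⟧ t → t ≡ f x ⊎ t ≡ f y
  side (v , vA , refl) with elems ie vA
  ... | inj₁ refl = inj₁ refl
  ... | inj₂ refl = inj₂ refl

DHom : {G H : Multigraph} → MHom G H → QHom (DQ G) (DQ H)
DHom {G} {H} φ = record
  { Vf = Vφ φ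
  ; Ef = λ d → dedge (Eφ φ (edge d)) (Vφ φ (src d)) (Vφ φ (tgt d))
                     (transportEnds (Vφ φ) (ε G (edge d)) (ε H (Eφ φ (edge d))) (hom φ (edge d)) (ok d))
  ; σ-hom = λ _ → refl
  ; τ-hom = λ _ → refl
  }

private
  okL : {X Y : Set} {A : Ends X} {v z : X} (w : Y) → IsEnds A v z → IsEnds (leftT A w) (v , w) (z , w)
  okL w lp = lp
  okL w fw = fw
  okL w bw = bw
  okR : {X Y : Set} {A : Ends Y} {w u : Y} (v : X) → IsEnds A w u → IsEnds (rightT v A) (v , w) (v , u)
  okR v lp = lp
  okR v fw = fw
  okR v bw = bw

ψ : (G H : Multigraph) → QHom (DQ G ⊠ DQ H) (DQ (G □ H))
ψ G H = record
  { Vf = λ { (v , w) → (v , w) }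
  ; Ef = λ { (inj₁ (dedge e v z o , w)) → dedge (inj₁ (e , w)) (v , w) (z , w) (okL w o)
           ; (inj₂ (v , dedge f w u o)) → dedge (inj₂ (v , f)) (v , w) (v , u) (okR v o) }
  ; σ-hom = λ { (inj₁ _) → refl ; (inj₂ _) → refl }
  ; τ-hom = λ { (inj₁ _) → refl ; (inj₂ _) → refl }
  }

ψ• : QHom IQ (DQ IM)
ψ• = record { Vf = λ { tt → tt } ; Ef = λ () ; σ-hom = λ () ; τ-hom = λ () }

record IsStrongSymmetricMonoidal-D : Set₁ where
  field
    ψ-natural : ∀ {G G' H H' : Multigraph} (φ : MHom G G') (χ : MHom H H') →
                ψ G' H' ∘Q (DHom φ ⊠₁ DHom χ) ≈Q DHom (φ □₁ χ) ∘Q ψ G H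
    ψ-iso : ∀ (G H : Multigraph) → IsIsoQ (ψ G H)
    ψ•-iso : IsIsoQ ψ•
    assoc : ∀ (G H K : Multigraph) →
            DHom (aM G H K) ∘Q ψ (G □ H) K ∘Q (ψ G H ⊠₁ idQ (DQ K))
              ≈Q ψ G (H □ K) ∘Q (idQ (DQ G) ⊠₁ ψ H K) ∘Q aQ (DQ G) (DQ H) (DQ K)
    unitʳ : ∀ (G : Multigraph) →
            DHom (rM G) ∘Q ψ G IM ∘Q (idQ (DQ G) ⊠₁ ψ•) ≈Q rQ (DQ G)
    unitˡ : ∀ (G : Multigraph) →
            DHom (ℓM G) ∘Q ψ IM G ∘Q (ψ• ⊠₁ idQ (DQ G)) ≈Q ℓQ (DQ G)
    symm : ∀ (G H : Multigraph) →
           DHom (cM G H) ∘Q ψ G H ≈Q ψ H G ∘Q cQ (DQ G) (DQ H)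

{-# OPTIONS --safe #-}
module Submission where

open import Defs
open import Data.Unit using (tt)
import Data.Empty.Irrelevant as Irr
open import Data.Product using (_×_; _,_; proj₁; proj₂)
open import Data.Sum using (inj₁; inj₂)
open import Relation.Binary.PropositionalEquality

-- An orientation of an edge is a proposition, so an oriented edge of D⃗K is
-- determined by its edge and its endpoints.  Every coherence diagram ends in a
-- quiver D⃗K, so it only has to be checked on vertices and underlying edges,
-- where it holds by the very formulas defining the structure maps.  On edges,
-- ψ is inverted by reading off from an orientation of (1,e,w) (resp. (2,v,f))
-- an orientation of e in layer w (resp. of f in layer v).

IsEnds-irrelevant : {X : Set} {A : Ends X} {x y : X} (o o' : IsEnds A x y) → o ≡ o'
IsEnds-irrelevant lp lp = refl
IsEnds-irrelevant fw fw = refl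
IsEnds-irrelevant bw bw = refl
IsEnds-irrelevant (fw {p = p}) bw = Irr.⊥-elim (p refl)
IsEnds-irrelevant (bw {p = p}) fw = Irr.⊥-elim (p refl)

DEdge-≡ : {K : Multigraph} {d d' : DEdge K} →
          edge d ≡ edge d' → src d ≡ src d' → tgt d ≡ tgt d' → d ≡ d'
DEdge-≡ {d = dedge e x y o} {dedge .e .x .y o'} refl refl refl =
  cong (dedge e x y) (IsEnds-irrelevant o o')

≈Q-intoD : {Q : Quiver} {K : Multigraph} (f g : QHom Q (DQ K)) →
           (∀ v → Vf f v ≡ Vf g v) → (∀ e → edge (Ef f e) ≡ edge (Ef g e)) → f ≈Q g
≈Q-intoD {Q} f g V≡ edge≡ = V≡ , λ e →
  DEdge-≡ (edge≡ e)
    (trans (σ-hom f e) (trans (V≡ (σ Q e)) (sym (σ-hom g e))))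
    (trans (τ-hom f e) (trans (V≡ (τ Q e)) (sym (τ-hom g e))))

module _ {X Y : Set} where
  IsEnds-leftT⁻ : (A : Ends X) (w : Y) {s t : X × Y} → IsEnds (leftT A w) s t →
                  IsEnds A (proj₁ s) (proj₁ t) × proj₂ s ≡ w × proj₂ t ≡ w
  IsEnds-leftT⁻ (one _) w lp = lp , refl , refl
  IsEnds-leftT⁻ (two _ _ _) w fw = fw , refl , refl
  IsEnds-leftT⁻ (two _ _ _) w bw = bw , refl , refl

  IsEnds-rightT⁻ : (v : X) (A : Ends Y) {s t : X × Y} → IsEnds (rightT v A) s t →
                   IsEnds A (proj₂ s) (proj₂ t) × proj₁ s ≡ v × proj₁ t ≡ v
  IsEnds-rightT⁻ v (one _) lp = lp , refl , refl
  IsEnds-rightT⁻ v (two _ _ _) fw = fw , refl , refl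
  IsEnds-rightT⁻ v (two _ _ _) bw = bw , refl , refl

ψ⁻¹ : (G H : Multigraph) → QHom (DQ (G □ H)) (DQ G ⊠ DQ H)
ψ⁻¹ G H = record { Vf = λ v → v ; Ef = split ; σ-hom = split-σ ; τ-hom = split-τ }
  where
  split : DEdge (G □ H) → QE (DQ G ⊠ DQ H)
  split (dedge (inj₁ (e , w)) s t o) =
    inj₁ (dedge e (proj₁ s) (proj₁ t) (proj₁ (IsEnds-leftT⁻ (ε G e) w o)) , w)
  split (dedge (inj₂ (v , f)) s t o) =
    inj₂ (v , dedge f (proj₂ s) (proj₂ t) (proj₁ (IsEnds-rightT⁻ v (ε H f) o)))

  split-σ : ∀ d → σ (DQ G ⊠ DQ H) (split d) ≡ src d
  split-σ (dedge (inj₁ (e , w)) s t o) =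
    cong (proj₁ s ,_) (sym (proj₁ (proj₂ (IsEnds-leftT⁻ (ε G e) w o))))
  split-σ (dedge (inj₂ (v , f)) s t o) =
    cong (_, proj₂ s) (sym (proj₁ (proj₂ (IsEnds-rightT⁻ v (ε H f) o))))

  split-τ : ∀ d → τ (DQ G ⊠ DQ H) (split d) ≡ tgt d
  split-τ (dedge (inj₁ (e , w)) s t o) =
    cong (proj₁ t ,_) (sym (proj₂ (proj₂ (IsEnds-leftT⁻ (ε G e) w o))))
  split-τ (dedge (inj₂ (v , f)) s t o) =
    cong (_, proj₂ t) (sym (proj₂ (proj₂ (IsEnds-rightT⁻ v (ε H f) o))))

ψ-isIso : (G H : Multigraph) → IsIsoQ (ψ G H)
ψ-isIso G H = ψ⁻¹ G H , ((λ _ → refl) , ψ⁻¹∘ψ) , ψ∘ψ⁻¹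
  where
  ψ⁻¹∘ψ : ∀ e → Ef (ψ⁻¹ G H ∘Q ψ G H) e ≡ e
  ψ⁻¹∘ψ (inj₁ (d , w)) = cong (λ d' → inj₁ (d' , w)) (DEdge-≡ refl refl refl)
  ψ⁻¹∘ψ (inj₂ (v , d)) = cong (λ d' → inj₂ (v , d')) (DEdge-≡ refl refl refl)

  ψ∘ψ⁻¹ : ψ G H ∘Q ψ⁻¹ G H ≈Q idQ (DQ (G □ H))
  ψ∘ψ⁻¹ = ≈Q-intoD (ψ G H ∘Q ψ⁻¹ G H) (idQ (DQ (G □ H))) (λ _ → refl)
    λ { (dedge (inj₁ _) _ _ _) → refl ; (dedge (inj₂ _) _ _ _) → refl }

ψ•-isIso : IsIsoQ ψ•
ψ•-isIso = record { Vf = λ _ → tt ; Ef = λ () ; σ-hom = λ () ; τ-hom = λ () }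
         , ((λ _ → refl) , λ ()) , ((λ _ → refl) , λ ())

mainTheorem14 : IsStrongSymmetricMonoidal-D
mainTheorem14 = record
  { ψ-natural = λ {G} {G'} {H} {H'} φ χ →
      ≈Q-intoD (ψ G' H' ∘Q (DHom φ ⊠₁ DHom χ)) (DHom (φ □₁ χ) ∘Q ψ G H) (λ _ → refl)
        λ { (inj₁ _) → refl ; (inj₂ _) → refl }
  ; ψ-iso = ψ-isIso
  ; ψ•-iso = ψ•-isIso
  ; assoc = λ G H K →
      ≈Q-intoD (DHom (aM G H K) ∘Q ψ (G □ H) K ∘Q (ψ G H ⊠₁ idQ (DQ K)))
               (ψ G (H □ K) ∘Q (idQ (DQ G) ⊠₁ ψ H K) ∘Q aQ (DQ G) (DQ H) (DQ K)) (λ _ → refl)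
        λ { (inj₁ (inj₁ _ , _)) → refl ; (inj₁ (inj₂ _ , _)) → refl ; (inj₂ _) → refl }
  ; unitʳ = λ G →
      ≈Q-intoD (DHom (rM G) ∘Q ψ G IM ∘Q (idQ (DQ G) ⊠₁ ψ•)) (rQ (DQ G)) (λ _ → refl)
        λ { (inj₁ (_ , tt)) → refl ; (inj₂ (_ , ())) }
  ; unitˡ = λ G →
      ≈Q-intoD (DHom (ℓM G) ∘Q ψ IM G ∘Q (ψ• ⊠₁ idQ (DQ G))) (ℓQ (DQ G)) (λ _ → refl)
        λ { (inj₂ (tt , _)) → refl ; (inj₁ (() , _)) }
  ; symm = λ G H →
      ≈Q-intoD (DHom (cM G H) ∘Q ψ G H) (ψ H G ∘Q cQ (DQ G) (DQ H)) (λ _ → refl)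
        λ { (inj₁ _) → refl ; (inj₂ _) → refl }
  }
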